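{- Let $\equiv$ be either $\equiv_{s,a}$ or $\equiv_{s,s}$. Let $T_1=\langle P_1,Q_1\rangle$ and $T_2=\langle P_2,Q_2\rangle$ be pairs of programs with $T_1\approx T_2$. (I) If $IC(T_1)=IC(T_2)$, then $P_1\equiv Q_1$ iff $P_2\equiv Q_2$. (II) If $IC(T_1)<IC(T_2)$, then $P_1\not\equiv Q_1$ implies $P_2\not\equiv Q_2$, and $P_2\equiv Q_2$ implies $P_1\equiv Q_1$.
   Context: Atoms are propositional. A rule $r$ is an expression $h_1\vee\cdots\vee h_k\leftarrow b_1,\dots,b_m,\mathit{not}\,c_1,\dots,\mathit{not}\,c_n$; write $H(r)$, $B^+(r)$, $B^-(r)$ for the sets of head, positive body and negative body atoms. A program is a finite set of rules. An interpretation $X$ satisfies $r$ iff $X\cap H(r)\neq\emptyset$ or $B^+(r)\not\subseteq X$ or $B^-(r)\cap X\neq\emptyset$. GL-reduct $P^X=\{H(r)\leftarrow B^+(r) : r\in P,\ B^-(r)\cap X=\emptyset\}$; $X$ is an ASP stable model of $P$ iff $X\models P^X$ and no proper subset of $X$ satisfies $P^X$; $X$ is an LP$^{\mathrm{MLN}}$ stable model of $P$ (weights omitted) iff $X$ is an ASP stable model of $\{r\in P: X\models r\}$. $P\equiv_{s,a}Q$ (resp. $P\equiv_{s,s}Q$) iff for every program $R$, $P\cup R$ and $Q\cup R$ have the same ASP (resp. LP$^{\mathrm{MLN}}$) stable models. Programs are regarded as tuples of rules (repetitions allowed); $\langle P,Q\rangle$ is the concatenation. For a tuple $T=\langle r_1,\dots,r_n\rangle$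 let $\langle S_1,\dots,S_{3n}\rangle=\langle H(r_1),B^+(r_1),B^-(r_1),\dots,H(r_n),B^+(r_n),B^-(r_n)\rangle$; for nonempty $N'\subseteq\{1,\dots,3n\}$ the independent set $I_{N'}=\bigcap_{i\in N'}S_i\setminus\bigcup_{j\notin N'}S_j$ is named $I_k$ with $k=\sum_{i\in N'}2^{3n-i}$ ($1\le k<2^{3n}$). Let $nis(T)$, $eis(T)$, $sis(T)$ be the sets of names $k$ with $I_k\neq\emptyset$, $I_k=\emptyset$, $|I_k|=1$ respectively. The IS-condition $IC(T)$ is the formula $\bigwedge_{i\in nis(T)}(I_i\neq\emptyset)\wedge\bigwedge_{j\in eis(T)}(I_j=\emptyset)\wedge\bigwedge_{k\in sis(T)}(|I_k|=1)$. For pairs, $\langle P_1,Q_1\rangle\approx\langle P_2,Q_2\rangle$ iff $|P_1|=|P_2|$ and $|Q_1|=|Q_2|$. For $T_1\approx T_2$: $IC(T_1)=IC(T_2)$ iff $nis(T_1)=nis(T_2)$ and $sis(T_1)=sis(T_2)$; $IC(T_1)<IC(T_2)$ iff $nis(T_1)=nis(T_2)$ and $sis(T_2)\subsetneq sis(T_1)$. -}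

module Defs where

open import Data.Nat using (ℕ; zero; suc; _+_; _*_; _≡ᵇ_; _≤_)
open import Data.Bool using (Bool; true; false; _∨_; not; if_then_else_)
open import Data.List using (List; []; _∷_; _++_; length; map; filterᵇ; concatMap; foldl)
open import Data.Bool.ListAction using (any; all)
open import Data.List.Relation.Unary.All using (All)
open import Data.Product using (Σ; _×_; ∃; _,_)
open import Relation.Binary.PropositionalEquality using (_≡_)
open import Relation.Nullary using (¬_)
open import Function.Bundles using (_⇔_)

-- A rule  h1 ∨ … ∨ hk ← b1,…,bm, not c1,…,not cn
-- is given by its three finite atom sets H(r), B⁺(r), B⁻(r) (as lists).

Atom : Set
Atom = ℕ

record Rule : Set where
  constructor rule
  field
    head : List Atom
    pos  : List Atom
    neg  : List Atom
open Rule public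

-- Programs are tuples (lists) of rules; P ∪ R is rendered as P ++ R
-- (all semantic notions below only depend on the set of rules).
Program : Set
Program = List Rule

Interp : Set
Interp = Atom → Bool

satR : Interp → Rule → Bool
satR X r = any X (head r) ∨ not (all X (pos r)) ∨ any X (neg r)

_⊨_ : Interp → Program → Set
X ⊨ P = All (λ r → satR X r ≡ true) P

reduct : Interp → Program → Program
reduct X P =
  map (λ r → rule (head r) (pos r) [])
      (filterᵇ (λ r → not (any X (neg r))) P)

_⊂_ : Interp → Interp → Set
Y ⊂ X = (∀ a → Y a ≡ true → X a ≡ true) × (∃ λ a → X a ≡ true × Y a ≡ false)

ASPStable : Program → Interp → Set
ASPStable P X = (X ⊨ reduct X P) × (∀ Y → Y ⊂ X → ¬ (Y ⊨ reduct X P))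

-- LP^MLN stable model (weights omitted):
-- X is an ASP stable model of { r ∈ P : X ⊨ r }
LPMLNStable : Program → Interp → Set
LPMLNStable P X = ASPStable (filterᵇ (satR X) P) X

data Semantics : Set where
  asp lpmln : Semantics

Stable : Semantics → Program → Interp → Set
Stable asp   = ASPStable
Stable lpmln = LPMLNStable

-- Strong equivalence: ≡_{s,a} for asp, ≡_{s,s} for lpmln
SE : Semantics → Program → Program → Set
SE e P Q = ∀ (R : Program) (X : Interp) → (Stable e (P ++ R) X ⇔ Stable e (Q ++ R) X)

-- Independent sets.  For T = ⟨r1,…,rn⟩, ⟨S1,…,S3n⟩ = ⟨H(r1),B⁺(r1),B⁻(r1),…⟩.

sets : List Rule → List (List Atom)
sets = concatMap (λ r → head r ∷ pos r ∷ neg r ∷ [])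

_∈ᵇ_ : Atom → List Atom → Bool
a ∈ᵇ l = any (λ x → a ≡ᵇ x) l

-- The name of (the independent set containing) atom a:
-- with N' = { i : a ∈ S_i },  name = Σ_{i ∈ N'} 2^(3n-i),
-- i.e. the binary number whose i-th most significant digit is [a ∈ S_i].
name : List Rule → Atom → ℕ
name T a = foldl (λ acc S → 2 * acc + (if a ∈ᵇ S then 1 else 0)) 0 (sets T)

-- I_k = { a : name a = k }, for k ≥ 1 (N' nonempty)
InIS : List Rule → ℕ → Atom → Set
InIS T k a = name T a ≡ k

nis : List Rule → ℕ → Set
nis T k = (1 ≤ k) × (∃ λ a → InIS T k a)

sis : List Rule → ℕ → Set
sis T k = (1 ≤ k) × (∃ λ a → InIS T k a × (∀ b → InIS T k b → b ≡ a))

Pair : Set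
Pair = Program × Program

tup : Pair → List Rule
tup (P , Q) = P ++ Q

_≈_ : Pair → Pair → Set
(P₁ , Q₁) ≈ (P₂ , Q₂) = (length P₁ ≡ length P₂) × (length Q₁ ≡ length Q₂)

ICeq : Pair → Pair → Set
ICeq T₁ T₂ = (∀ k → nis (tup T₁) k ⇔ nis (tup T₂) k)
           × (∀ k → sis (tup T₁) k ⇔ sis (tup T₂) k)

IClt : Pair → Pair → Set
IClt T₁ T₂ = (∀ k → nis (tup T₁) k ⇔ nis (tup T₂) k)
           × (∀ k → sis (tup T₂) k → sis (tup T₁) k)
           × (∃ λ k → sis (tup T₁) k × ¬ sis (tup T₂) k)

-- Both ≡_{s,a} and ≡_{s,s} are characterised by SE-models: pairs Y ⊆ X with X ⊨ P^X and Y ⊨ P^X (for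
-- LP^MLN the reduct is taken of the rules of P that X satisfies). If P ≡ Q, an SE-model (Y, X) of P,
-- restricted to the atoms of P ∪ Q, is one of Q: otherwise adding the facts Y and the rules a ← b for
-- a, b ∈ X ∖ Y makes X stable for exactly one of P and Q.
-- Whether (Y, X) is an SE-model of a rule only depends on whether Y and X meet or contain its head and
-- bodies, and these are unions of independent sets. Given T₁ ≈ T₂ with nis(T₁) = nis(T₂) and
-- sis(T₂) ⊆ sis(T₁), an interpretation of T₁ is carried to T₂ one independent set at a time: where it is
-- constant it keeps the constant, and where it is mixed the independent set has two atoms, so it is no
-- singleton in T₂ either and can be made mixed there. This transport is monotone and preserves the
-- SE-models of corresponding rules, so SE-model inclusion, hence strong equivalence, passes from T₂ to T₁.

module Submission where

open import Defs
open import Data.Bool using (Bool; true; false; _∨_; _∧_; not; if_then_else_)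
open import Data.Bool.Properties using (∨-zeroʳ; ∧-zeroʳ; ∨-identityʳ; ∧-identityʳ; T-≡; ⇔→≡; not-injective; ¬-not)
open import Data.Bool.ListAction using (any; all; or; and)
open import Data.Nat using (ℕ; suc; _+_; _*_; _≡ᵇ_; _≤_)
open import Data.Nat.Properties using (≡ᵇ⇒≡; ≡⇒≡ᵇ; *-cancelˡ-≡; even≢odd; +-comm; +-identityʳ; suc-injective; ≤-refl; ≤-trans; m≤m+n; m≤n+m; 1+n≰n)
open import Data.List using (List; []; _∷_; _++_; length; map; filterᵇ; concat; concatMap; foldl; cartesianProduct)
open import Data.List.Properties using (map-cong-local; foldl-map; length-map; length-++; ∷-injectiveˡ; ∷-injectiveʳ)
open import Data.List.Membership.Propositional using (_∈_)
open import Data.List.Membership.Propositional.Properties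
  using (∈-++⁺ˡ; ∈-++⁺ʳ; ∈-map⁺; ∈-map⁻; ∈-cartesianProduct⁺; ∈-filter⁺; ∈-filter⁻; ∈-cartesianProduct⁻; ∈-concat⁺′; ∈-concat⁻′)
open import Data.List.Relation.Binary.Subset.Propositional using () renaming (_⊆_ to _⊆ˡ_)
open import Data.List.Relation.Unary.Any using (here; there)
open import Data.List.Relation.Unary.All using (All; []; _∷_; tabulate; lookup; universal)
open import Data.List.Relation.Unary.All.Properties using (++⁺; ++⁻; map⁺; map⁻)
open import Data.List.Relation.Binary.Pointwise using (Pointwise; []; _∷_) renaming (map to pointwise-map)
open import Data.Product using (_×_; ∃-syntax; _,_; proj₁; proj₂)
open import Data.Sum using (_⊎_; inj₁; inj₂; [_,_])
open import Data.Empty using (⊥-elim)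
open import Function using (_∘_; id; _⇔_; mk⇔; Equivalence)
open import Function.Properties.Equivalence using () renaming (sym to ⇔-sym; trans to ⇔-trans)
open import Relation.Binary.PropositionalEquality
  using (_≡_; _≢_; _≗_; refl; sym; trans; cong; cong₂; subst)
open import Relation.Nullary using (¬_)
open import Relation.Nullary.Decidable using (T?)

open Equivalence using (to; from)

private
  variable
    A : Set

≡ᵇ⇔≡ : ∀ {m n} → (m ≡ᵇ n) ≡ true ⇔ m ≡ n
≡ᵇ⇔≡ {m} {n} = mk⇔ (≡ᵇ⇒≡ m n ∘ from T-≡) (to T-≡ ∘ ≡⇒≡ᵇ m n)

true≢false : true ≢ false
true≢false ()

∧-≡true : ∀ {x y} → x ∧ y ≡ true → x ≡ true × y ≡ true
∧-≡true {true} y≡true = refl , y≡true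

any≡true⇔ : (p : A → Bool) (xs : List A) → any p xs ≡ true ⇔ (∃[ x ] x ∈ xs × p x ≡ true)
any≡true⇔ p xs = mk⇔ (witness xs) hit
  where
  witness : ∀ xs → any p xs ≡ true → ∃[ x ] x ∈ xs × p x ≡ true
  witness (x ∷ xs) h with p x in px
  ... | true  = x , here refl , px
  ... | false = let y , y∈xs , py = witness xs h in y , there y∈xs , py
  hit : ∀ {xs} → ∃[ x ] x ∈ xs × p x ≡ true → any p xs ≡ true
  hit {_ ∷ xs} (x , here refl , px) = cong (_∨ any p xs) px
  hit {y ∷ xs} (x , there x∈xs , px) = trans (cong (p y ∨_) (hit (x , x∈xs , px))) (∨-zeroʳ (p y))

all≡false⇔ : (p : A → Bool) (xs : List A) → all p xs ≡ false ⇔ (∃[ x ] x ∈ xs × p x ≡ false)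
all≡false⇔ p xs = mk⇔ (witness xs) hit
  where
  witness : ∀ xs → all p xs ≡ false → ∃[ x ] x ∈ xs × p x ≡ false
  witness (x ∷ xs) h with p x in px
  ... | false = x , here refl , px
  ... | true  = let y , y∈xs , py = witness xs h in y , there y∈xs , py
  hit : ∀ {xs} → ∃[ x ] x ∈ xs × p x ≡ false → all p xs ≡ false
  hit {_ ∷ xs} (x , here refl , px) = cong (_∧ all p xs) px
  hit {y ∷ xs} (x , there x∈xs , px) = trans (cong (p y ∧_) (hit (x , x∈xs , px))) (∧-zeroʳ (p y))

All⇔all≡true : (p : A → Bool) (xs : List A) → All (λ x → p x ≡ true) xs ⇔ all p xs ≡ true
All⇔all≡true p xs = mk⇔ join (split xs)
  where
  split : ∀ xs → all p xs ≡ true → All (λ x → p x ≡ true) xs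
  split []       _ = []
  split (x ∷ xs) h = let px , pxs = ∧-≡true h in px ∷ split xs pxs
  join : ∀ {xs} → All (λ x → p x ≡ true) xs → all p xs ≡ true
  join []                  = refl
  join {x ∷ xs} (px ∷ pxs) = trans (cong (_∧ all p xs) px) (join pxs)

∈ᵇ⇔∈ : ∀ {a xs} → a ∈ᵇ xs ≡ true ⇔ a ∈ xs
∈ᵇ⇔∈ {a} {xs} = mk⇔
  (λ h → let x , x∈xs , a≡x = to (any≡true⇔ (a ≡ᵇ_) xs) h in subst (_∈ xs) (sym (to ≡ᵇ⇔≡ a≡x)) x∈xs)
  (λ a∈xs → from (any≡true⇔ (a ≡ᵇ_) xs) (a , a∈xs , from (≡ᵇ⇔≡ {a}) refl))

∈-filterᵇ⁺ : ∀ {p : A → Bool} {x xs} → x ∈ xs → p x ≡ true → x ∈ filterᵇ p xs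
∈-filterᵇ⁺ {p = p} x∈xs px = ∈-filter⁺ (T? ∘ p) x∈xs (from T-≡ px)

∈-filterᵇ⁻ : ∀ {p : A → Bool} {x} xs → x ∈ filterᵇ p xs → p x ≡ true
∈-filterᵇ⁻ {p = p} xs x∈ = to T-≡ (proj₂ (∈-filter⁻ (T? ∘ p) {xs = xs} x∈))

-- (X ∩ H(r) ≠ ∅ , B⁺(r) ⊆ X , X ∩ B⁻(r) ≠ ∅): all that matters of a rule r under an interpretation X.
View : Set
View = Bool × Bool × Bool

view : Interp → Rule → View
view X r = any X (head r) , all X (pos r) , any X (neg r)

satV : View → Bool
satV (h , p , n) = h ∨ not p ∨ n

-- Y ⊨ r^X, a rule deleted by the reduct counting as satisfied; for LP^MLN, r only counts if X ⊨ r.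
modelV : Semantics → (viewY viewX : View) → Bool
modelV asp   (h , p , _) (_ , _ , n) = n ∨ satV (h , p , false)
modelV lpmln y x                     = not (satV x) ∨ modelV asp y x

holds : Semantics → (Y X : Interp) → Program → Bool
holds e Y X []      = true
holds e Y X (r ∷ P) = modelV e (view Y r) (view X r) ∧ holds e Y X P

holds-++ : ∀ e Y X P Q → holds e Y X (P ++ Q) ≡ holds e Y X P ∧ holds e Y X Q
holds-++ e Y X []      Q = refl
holds-++ e Y X (r ∷ P) Q with modelV e (view Y r) (view X r)
... | true  = holds-++ e Y X P Q
... | false = refl

holds-++⁻ : ∀ {e Y X} P {Q} → holds e Y X (P ++ Q) ≡ true → holds e Y X P ≡ true × holds e Y X Q ≡ true
holds-++⁻ {e} {Y} {X} P {Q} h = ∧-≡true (trans (sym (holds-++ e Y X P Q)) h)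

holds-++⁺ : ∀ {e Y X} P {Q} → holds e Y X P ≡ true → holds e Y X Q ≡ true → holds e Y X (P ++ Q) ≡ true
holds-++⁺ {e} {Y} {X} P {Q} hP hQ = trans (holds-++ e Y X P Q) (cong₂ _∧_ hP hQ)

Stableᵇ : Semantics → Program → Interp → Set
Stableᵇ e P X = holds e X X P ≡ true × (∀ Y → Y ⊂ X → holds e Y X P ≢ true)

relevant : Semantics → Interp → Program → Program
relevant asp   X P = P
relevant lpmln X P = filterᵇ (satR X) P

all-reduct : ∀ Y X P → all (satR Y) (reduct X P) ≡ holds asp Y X P
all-reduct Y X []      = refl
all-reduct Y X (r ∷ P) with any X (neg r)
... | true  = all-reduct Y X P
... | false = cong (satR Y (rule (head r) (pos r) []) ∧_) (all-reduct Y X P)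

⊨reduct⇔holds : ∀ e Y X P → Y ⊨ reduct X (relevant e X P) ⇔ holds e Y X P ≡ true
⊨reduct⇔holds e Y X P = mk⇔
  (λ Y⊨ → trans (sym (all-relevant e)) (to (All⇔all≡true (satR Y) _) Y⊨))
  (λ h → from (All⇔all≡true (satR Y) _) (trans (all-relevant e) h))
  where
  all-relevant : ∀ e → all (satR Y) (reduct X (relevant e X P)) ≡ holds e Y X P
  all-relevant asp   = all-reduct Y X P
  all-relevant lpmln = trans (all-reduct Y X (filterᵇ (satR X) P)) (holds-filterᵇ P)
    where
    holds-filterᵇ : ∀ P → holds asp Y X (filterᵇ (satR X) P) ≡ holds lpmln Y X P
    holds-filterᵇ []      = refl
    holds-filterᵇ (r ∷ P) with satR X r
    ... | true  = cong (modelV asp (view Y r) (view X r) ∧_) (holds-filterᵇ P)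
    ... | false = holds-filterᵇ P

relevant-stable⇔ : ∀ e P X → ASPStable (relevant e X P) X ⇔ Stableᵇ e P X
relevant-stable⇔ e P X = mk⇔
  (λ (model , minimal) → to (⊨reduct⇔holds e X X P) model
                       , λ Y Y⊂X h → minimal Y Y⊂X (from (⊨reduct⇔holds e Y X P) h))
  (λ (model , minimal) → from (⊨reduct⇔holds e X X P) model
                       , λ Y Y⊂X Y⊨ → minimal Y Y⊂X (to (⊨reduct⇔holds e Y X P) Y⊨))

stable⇔stableᵇ : ∀ e P X → Stable e P X ⇔ Stableᵇ e P X
stable⇔stableᵇ asp   = relevant-stable⇔ asp
stable⇔stableᵇ lpmln = relevant-stable⇔ lpmln

_⊆_ : Interp → Interp → Set
Y ⊆ X = ∀ a → Y a ≡ true → X a ≡ true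

SEModel : Semantics → Program → (Y X : Interp) → Set
SEModel e P Y X = Y ⊆ X × holds e X X P ≡ true × holds e Y X P ≡ true

SEModels⊆ : Semantics → Program → Program → Set
SEModels⊆ e P Q = ∀ Y X → SEModel e P Y X → SEModel e Q Y X

stableᵇ-transfer : ∀ e P Q R {X} → SEModels⊆ e P Q → SEModels⊆ e Q P
                 → Stableᵇ e (P ++ R) X → Stableᵇ e (Q ++ R) X
stableᵇ-transfer e P Q R {X} P⊆Q Q⊆P (model , minimal) = holds-++⁺ Q XQ XR , minimal′
  where
  XP = proj₁ (holds-++⁻ P model)
  XR = proj₂ (holds-++⁻ P model)
  XQ = proj₁ (proj₂ (P⊆Q X X ((λ _ → id) , XP , XP)))
  minimal′ : ∀ Y → Y ⊂ X → holds e Y X (Q ++ R) ≢ true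
  minimal′ Y Y⊂X h = minimal Y Y⊂X (holds-++⁺ P YP YR)
    where
    YR = proj₂ (holds-++⁻ Q h)
    YP = proj₂ (proj₂ (Q⊆P Y X (proj₁ Y⊂X , XQ , proj₁ (holds-++⁻ Q h))))

SEModels⇒SE : ∀ e P Q → SEModels⊆ e P Q → SEModels⊆ e Q P → SE e P Q
SEModels⇒SE e P Q P⊆Q Q⊆P R X =
  ⇔-trans (stable⇔stableᵇ e _ X)
    (⇔-trans (mk⇔ (stableᵇ-transfer e P Q R P⊆Q Q⊆P) (stableᵇ-transfer e Q P R Q⊆P P⊆Q))
             (⇔-sym (stable⇔stableᵇ e _ X)))

SE⇒stableᵇ⇔ : ∀ e P Q → SE e P Q → ∀ R X → Stableᵇ e (P ++ R) X ⇔ Stableᵇ e (Q ++ R) X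
SE⇒stableᵇ⇔ e P Q P≡Q R X =
  ⇔-trans (⇔-sym (stable⇔stableᵇ e _ X)) (⇔-trans (P≡Q R X) (stable⇔stableᵇ e _ X))

ruleAtoms : Rule → List Atom
ruleAtoms r = head r ++ pos r ++ neg r

view-local : ∀ {Z Z′} r → (∀ {a} → a ∈ ruleAtoms r → Z a ≡ Z′ a) → view Z r ≡ view Z′ r
view-local {Z} {Z′} r agree =
  cong₂ _,_ (cong or (on (head r) λ a∈ → agree (∈-++⁺ˡ a∈)))
    (cong₂ _,_ (cong and (on (pos r) λ a∈ → agree (∈-++⁺ʳ (head r) (∈-++⁺ˡ a∈))))
               (cong or (on (neg r) λ a∈ → agree (∈-++⁺ʳ (head r) (∈-++⁺ʳ (pos r) a∈)))))
  where
  on : ∀ S → (∀ {a} → a ∈ S → Z a ≡ Z′ a) → map Z S ≡ map Z′ S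
  on S agreeS = map-cong-local (tabulate {xs = S} agreeS)

holds-≗ : ∀ e {Y Y′} X P → Y ≗ Y′ → holds e Y X P ≡ holds e Y′ X P
holds-≗ e X []      Y≗Y′ = refl
holds-≗ e X (r ∷ P) Y≗Y′ =
  cong₂ _∧_ (cong (λ y → modelV e y (view X r)) (view-local r λ {a} _ → Y≗Y′ a)) (holds-≗ e X P Y≗Y′)

_≅[_]_ : Rule → (Interp → Interp) → Rule → Set
r₁ ≅[ f ] r₂ = ∀ Z → view Z r₁ ≡ view (f Z) r₂

holds-≅ : ∀ {f P₁ P₂} → Pointwise (_≅[ f ]_) P₁ P₂ → ∀ e Y X → holds e Y X P₁ ≡ holds e (f Y) (f X) P₂
holds-≅ []              e Y X = refl
holds-≅ (r₁≅r₂ ∷ P₁≅P₂) e Y X = cong₂ _∧_ (cong₂ (modelV e) (r₁≅r₂ Y) (r₁≅r₂ X)) (holds-≅ P₁≅P₂ e Y X)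

SEModels⊆-transport : ∀ {e P₁ Q₁ P₂ Q₂} (f : Interp → Interp) → (∀ {Y X} → Y ⊆ X → f Y ⊆ f X)
  → Pointwise (_≅[ f ]_) P₁ P₂ → Pointwise (_≅[ f ]_) Q₁ Q₂
  → SEModels⊆ e P₂ Q₂ → SEModels⊆ e P₁ Q₁
SEModels⊆-transport {e} f f-mono P₁≅P₂ Q₁≅Q₂ P₂⊆Q₂ Y X (Y⊆X , XP , YP)
  with P₂⊆Q₂ (f Y) (f X) (f-mono Y⊆X , trans (sym (holds-≅ P₁≅P₂ e X X)) XP , trans (sym (holds-≅ P₁≅P₂ e Y X)) YP)
... | _ , XQ , YQ = Y⊆X , trans (holds-≅ Q₁≅Q₂ e X X) XQ , trans (holds-≅ Q₁≅Q₂ e Y X) YQ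

-- Strong equivalence determines the SE-models

fact : Atom → Rule
fact a = rule (a ∷ []) [] []

link : Atom × Atom → Rule
link (a , b) = rule (a ∷ []) (b ∷ []) []

satR-fact : ∀ Z a → satR Z (fact a) ≡ Z a
satR-fact Z a = trans (∨-identityʳ _) (∨-identityʳ (Z a))

satR-link⇔ : ∀ Z a b → satR Z (link (a , b)) ≡ true ⇔ (Z b ≡ true → Z a ≡ true)
satR-link⇔ Z a b with Z a | Z b
... | true  | _     = mk⇔ (λ _ _ → refl) (λ _ → refl)
... | false | true  = mk⇔ (λ ()) (λ h → h refl)
... | false | false = mk⇔ (λ _ ()) (λ _ → refl)

holds-negFree : ∀ e Z X R → All (λ r → neg r ≡ []) R → X ⊨ R → holds e Z X R ≡ all (satR Z) R
holds-negFree e Z X []                 []          []          = refl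
holds-negFree e Z X (rule h p .[] ∷ R) (refl ∷ nf) (Xr ∷ X⊨R) =
  cong₂ _∧_ (modelV-negFree e) (holds-negFree e Z X R nf X⊨R)
  where
  modelV-negFree : ∀ e → modelV e (view Z (rule h p [])) (view X (rule h p [])) ≡ satR Z (rule h p [])
  modelV-negFree asp   = refl
  modelV-negFree lpmln = cong (λ s → not s ∨ satR Z (rule h p [])) Xr

⊂-irrefl : ∀ {X} → ¬ X ⊂ X
⊂-irrefl (_ , c , Xc , Xc′) = true≢false (trans (sym Xc) Xc′)

module Pin (L : List Atom) {Y X : Interp} (Y⊆X : Y ⊆ X) (X⊆L : ∀ a → X a ≡ true → a ∈ L) where

  gap : List Atom
  gap = filterᵇ (λ a → X a ∧ not (Y a)) L

  -- The facts force Y; the links force the whole gap X ∖ Y as soon as one atom of it is true.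
  pin : Program
  pin = map fact (filterᵇ Y L) ++ map link (cartesianProduct gap gap)

  ∈-gap : ∀ {a} → X a ≡ true → Y a ≡ false → a ∈ gap
  ∈-gap {a} Xa Ya = ∈-filterᵇ⁺ (X⊆L a Xa) (cong₂ _∧_ Xa (cong not Ya))

  gap-⊆ : ∀ {a} → a ∈ gap → X a ≡ true × Y a ≡ false
  gap-⊆ a∈ = let Xa , nYa = ∧-≡true (∈-filterᵇ⁻ L a∈) in Xa , not-injective nYa

  ⊨pin : ∀ {Z} → Y ⊆ Z → (∀ {a b} → a ∈ gap → b ∈ gap → Z b ≡ true → Z a ≡ true) → Z ⊨ pin
  ⊨pin {Z} Y⊆Z closed =
    ++⁺ (map⁺ (tabulate λ {a} a∈ → trans (satR-fact Z a) (Y⊆Z a (∈-filterᵇ⁻ L a∈))))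
        (map⁺ (tabulate λ {ab} ab∈ → let a∈ , b∈ = ∈-cartesianProduct⁻ gap gap ab∈
                                     in from (satR-link⇔ Z (proj₁ ab) (proj₂ ab)) (closed a∈ b∈)))

  X⊨pin : X ⊨ pin
  X⊨pin = ⊨pin Y⊆X (λ a∈ _ _ → proj₁ (gap-⊆ a∈))

  Y⊨pin : Y ⊨ pin
  Y⊨pin = ⊨pin (λ _ → id) (λ _ b∈ Yb → ⊥-elim (true≢false (trans (sym Yb) (proj₂ (gap-⊆ b∈)))))

  pin-forces : ∀ {Z} → Z ⊨ pin → Z ⊂ X → Z ≗ Y
  pin-forces {Z} Z⊨pin (Z⊆X , c , Xc , Zc) a = ⇔→≡ (mk⇔ (Z⊆Y a) (Y⊆Z a))
    where
    facts = map⁻ (proj₁ (++⁻ (map fact (filterᵇ Y L)) Z⊨pin))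
    links = map⁻ (proj₂ (++⁻ (map fact (filterᵇ Y L)) Z⊨pin))
    Y⊆Z : Y ⊆ Z
    Y⊆Z a Ya = trans (sym (satR-fact Z a)) (lookup facts (∈-filterᵇ⁺ (X⊆L a (Y⊆X a Ya)) Ya))
    Z⊆Y : Z ⊆ Y
    Z⊆Y a Za with Y a in Ya | Y c in Yc
    ... | true  | _     = refl
    ... | false | true  = ⊥-elim (true≢false (trans (sym (Y⊆Z c Yc)) Zc))
    ... | false | false = ⊥-elim (true≢false (trans (sym Zc-from-Za) Zc))
      where
      Zc-from-Za = to (satR-link⇔ Z c a)
                      (lookup links (∈-cartesianProduct⁺ (∈-gap Xc Yc) (∈-gap (Z⊆X a Za) Ya))) Za

  ≗⊎⊂ : Y ≗ X ⊎ Y ⊂ X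
  ≗⊎⊂ with gap in g
  ... | c ∷ _ = inj₂ (Y⊆X , c , gap-⊆ (subst (c ∈_) (sym g) (here refl)))
  ... | []    = inj₁ λ a → ⇔→≡ (mk⇔ (Y⊆X a) (X⊆Y a))
    where
    X⊆Y : X ⊆ Y
    X⊆Y a Xa with Y a in Ya
    ... | true  = refl
    ... | false with () ← subst (a ∈_) g (∈-gap Xa Ya)

  pin-negFree : All (λ r → neg r ≡ []) pin
  pin-negFree = ++⁺ (map⁺ {f = fact} (universal (λ _ → refl) (filterᵇ Y L)))
                    (map⁺ {f = link} (universal (λ _ → refl) (cartesianProduct gap gap)))

  holds-pin⇔ : ∀ e Z → holds e Z X pin ≡ true ⇔ Z ⊨ pin
  holds-pin⇔ e Z = mk⇔ (λ h → from (All⇔all≡true (satR Z) pin) (trans (sym negFree-holds) h))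
                       (λ Z⊨pin → trans negFree-holds (to (All⇔all≡true (satR Z) pin) Z⊨pin))
    where
    negFree-holds = holds-negFree e Z X pin pin-negFree X⊨pin

  stable-with-pin : ∀ e G → holds e X X G ≡ true → (Y ⊂ X → holds e Y X G ≢ true) → Stableᵇ e (G ++ pin) X
  stable-with-pin e G XG Y-fails = holds-++⁺ G XG (from (holds-pin⇔ e X) X⊨pin) , minimal
    where
    minimal : ∀ Z → Z ⊂ X → holds e Z X (G ++ pin) ≢ true
    minimal Z Z⊂X@(Z⊆X , c , Xc , Zc) h = Y-fails Y⊂X (trans (holds-≗ e X G (sym ∘ Z≗Y)) (proj₁ (holds-++⁻ G h)))
      where
      Z≗Y = pin-forces (to (holds-pin⇔ e Z) (proj₂ (holds-++⁻ G h))) Z⊂X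
      Y⊂X : Y ⊂ X
      Y⊂X = (λ a Ya → Z⊆X a (trans (Z≗Y a) Ya)) , c , Xc , trans (sym (Z≗Y c)) Zc

restrict : List Atom → Interp → Interp
restrict L Z a = Z a ∧ (a ∈ᵇ L)

restrict-⊆L : ∀ L Z a → restrict L Z a ≡ true → a ∈ L
restrict-⊆L L Z a h = to ∈ᵇ⇔∈ (proj₂ (∧-≡true h))

restrict-mono : ∀ L {Y X} → Y ⊆ X → restrict L Y ⊆ restrict L X
restrict-mono L Y⊆X a h = let Ya , a∈L = ∧-≡true h in cong₂ _∧_ (Y⊆X a Ya) a∈L

restrict-≅ : ∀ L G → (∀ {r} → r ∈ G → ruleAtoms r ⊆ˡ L) → Pointwise (_≅[ restrict L ]_) G G
restrict-≅ L []      G⊆L = []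
restrict-≅ L (r ∷ G) G⊆L = (λ Z → view-local r λ a∈ → sym (restrict-on Z (G⊆L (here refl) a∈)))
                         ∷ restrict-≅ L G (G⊆L ∘ there)
  where
  restrict-on : ∀ Z {a} → a ∈ L → restrict L Z a ≡ Z a
  restrict-on Z {a} a∈L = trans (cong (Z a ∧_) (from ∈ᵇ⇔∈ a∈L)) (∧-identityʳ (Z a))

SE⇒SEModels⊆ : ∀ e P Q → SE e P Q → SEModels⊆ e P Q
SE⇒SEModels⊆ e P Q P≡Q Y X (Y⊆X , XP , YP) = Y⊆X , XQ , YQ
  where
  L  = concatMap ruleAtoms (P ++ Q)
  X↓ = restrict L X
  Y↓ = restrict L Y

  P≅ : Pointwise (_≅[ restrict L ]_) P P
  P≅ = restrict-≅ L P λ r∈ a∈ → ∈-concat⁺′ a∈ (∈-map⁺ ruleAtoms (∈-++⁺ˡ r∈))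
  Q≅ : Pointwise (_≅[ restrict L ]_) Q Q
  Q≅ = restrict-≅ L Q λ r∈ a∈ → ∈-concat⁺′ a∈ (∈-map⁺ ruleAtoms (∈-++⁺ʳ P r∈))

  X↓P : holds e X↓ X↓ P ≡ true
  X↓P = trans (sym (holds-≅ P≅ e X X)) XP

  XQ : holds e X X Q ≡ true
  XQ = trans (holds-≅ Q≅ e X X) (proj₁ (holds-++⁻ Q (proj₁ (to (SE⇒stableᵇ⇔ e P Q P≡Q pin X↓) stableP))))
    where
    open Pin L {X↓} {X↓} (λ _ → id) (restrict-⊆L L X)
    stableP = stable-with-pin e P X↓P λ X↓⊂X↓ _ → ⊂-irrefl X↓⊂X↓

  X↓Q : holds e X↓ X↓ Q ≡ true
  X↓Q = trans (sym (holds-≅ Q≅ e X X)) XQ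

  Y↓Q≢false : holds e Y↓ X↓ Q ≢ false
  Y↓Q≢false Y↓Q = [ Y↓≗X↓-impossible , Y↓⊂X↓-impossible ] ≗⊎⊂
    where
    open Pin L {Y↓} {X↓} (restrict-mono L Y⊆X) (restrict-⊆L L X)
    Y↓≗X↓-impossible : ¬ Y↓ ≗ X↓
    Y↓≗X↓-impossible Y↓≗X↓ = true≢false (trans (sym X↓Q) (trans (sym (holds-≗ e X↓ Q Y↓≗X↓)) Y↓Q))
    Y↓⊂X↓-impossible : ¬ Y↓ ⊂ X↓
    Y↓⊂X↓-impossible Y↓⊂X↓ = proj₂ stableP Y↓ Y↓⊂X↓ (holds-++⁺ P Y↓P (from (holds-pin⇔ e Y↓) Y⊨pin))
      where
      stableP = from (SE⇒stableᵇ⇔ e P Q P≡Q pin X↓) (stable-with-pin e Q X↓Q λ _ h → true≢false (trans (sym h) Y↓Q))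
      Y↓P = trans (sym (holds-≅ P≅ e Y X)) YP

  YQ : holds e Y X Q ≡ true
  YQ with holds e Y X Q in YQ≡
  ... | true  = refl
  ... | false = ⊥-elim (Y↓Q≢false (trans (sym (holds-≅ Q≅ e Y X)) YQ≡))

-- Names of independent sets

atoms : List Rule → List Atom
atoms G = concat (sets G)

bits : List Rule → Atom → List Bool
bits G a = map (a ∈ᵇ_) (sets G)

fromBits : ℕ → List Bool → ℕ
fromBits = foldl (λ acc b → 2 * acc + (if b then 1 else 0))

name≡fromBits : ∀ G a → name G a ≡ fromBits 0 (bits G a)
name≡fromBits G a = sym (foldl-map _ (a ∈ᵇ_) 0 (sets G))

twice+digit-injective : ∀ m n b c → 2 * m + (if b then 1 else 0) ≡ 2 * n + (if c then 1 else 0) → m ≡ n × b ≡ c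
twice+digit-injective m n false false eq =
  *-cancelˡ-≡ m n 2 (trans (sym (+-identityʳ (2 * m))) (trans eq (+-identityʳ (2 * n)))) , refl
twice+digit-injective m n true  true  eq =
  *-cancelˡ-≡ m n 2 (suc-injective (trans (+-comm 1 (2 * m)) (trans eq (+-comm (2 * n) 1)))) , refl
twice+digit-injective m n true  false eq =
  ⊥-elim (even≢odd n m (sym (trans (+-comm 1 (2 * m)) (trans eq (+-identityʳ (2 * n))))))
twice+digit-injective m n false true  eq =
  ⊥-elim (even≢odd m n (trans (sym (+-identityʳ (2 * m))) (trans eq (+-comm (2 * n) 1))))

fromBits-injective : ∀ m n bs cs → length bs ≡ length cs → fromBits m bs ≡ fromBits n cs → m ≡ n × bs ≡ cs
fromBits-injective m n []       []       _   eq = eq , refl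
fromBits-injective m n (b ∷ bs) (c ∷ cs) len eq
  with fromBits-injective _ _ bs cs (suc-injective len) eq
... | digits≡ , bs≡cs with twice+digit-injective m n b c digits≡
...   | refl , refl = refl , cong (b ∷_) bs≡cs

fromBits-≥ : ∀ m bs → m ≤ fromBits m bs
fromBits-≥ m []       = ≤-refl
fromBits-≥ m (b ∷ bs) = ≤-trans (≤-trans (m≤m+n m (m + 0)) (m≤m+n (2 * m) _)) (fromBits-≥ _ bs)

fromBits-positive : ∀ m bs → true ∈ bs → 1 ≤ fromBits m bs
fromBits-positive m (b ∷ bs) (here refl) = ≤-trans (m≤n+m 1 (2 * m)) (fromBits-≥ _ bs)
fromBits-positive m (b ∷ bs) (there t∈) = fromBits-positive _ bs t∈

fromBits-zeros : ∀ bs → ¬ true ∈ bs → fromBits 0 bs ≡ 0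
fromBits-zeros []           _   = refl
fromBits-zeros (false ∷ bs) t∉ = fromBits-zeros bs (t∉ ∘ there)
fromBits-zeros (true  ∷ bs) t∉ = ⊥-elim (t∉ (here refl))

∈atoms⇔1≤name : ∀ G {a} → a ∈ atoms G ⇔ 1 ≤ name G a
∈atoms⇔1≤name G {a} = mk⇔ positive occurs
  where
  true∈bits⇒∈atoms : true ∈ bits G a → a ∈ atoms G
  true∈bits⇒∈atoms t∈ = let S , S∈ , t≡ = ∈-map⁻ (a ∈ᵇ_) t∈ in ∈-concat⁺′ (to ∈ᵇ⇔∈ (sym t≡)) S∈
  positive : a ∈ atoms G → 1 ≤ name G a
  positive a∈ = let S , a∈S , S∈ = ∈-concat⁻′ (sets G) a∈ in
    subst (1 ≤_) (sym (name≡fromBits G a))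
          (fromBits-positive 0 (bits G a) (subst (_∈ bits G a) (from ∈ᵇ⇔∈ a∈S) (∈-map⁺ (a ∈ᵇ_) S∈)))
  absent-name : a ∈ᵇ atoms G ≡ false → name G a ≡ 0
  absent-name a∉ = trans (name≡fromBits G a) (fromBits-zeros (bits G a) λ t∈ →
    true≢false (trans (sym (from ∈ᵇ⇔∈ (true∈bits⇒∈atoms t∈))) a∉))
  occurs : 1 ≤ name G a → a ∈ atoms G
  occurs 1≤name with a ∈ᵇ atoms G in a∈ᵇ
  ... | true  = to ∈ᵇ⇔∈ a∈ᵇ
  ... | false = ⊥-elim (1+n≰n (subst (1 ≤_) (absent-name a∈ᵇ) 1≤name))

sets-length : ∀ G₁ G₂ → length G₁ ≡ length G₂ → length (sets G₁) ≡ length (sets G₂)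
sets-length []        []        _   = refl
sets-length (_ ∷ G₁) (_ ∷ G₂) len = cong (suc ∘ suc ∘ suc) (sets-length G₁ G₂ (suc-injective len))

name-injective : ∀ G₁ G₂ → length G₁ ≡ length G₂ → ∀ a b → name G₁ a ≡ name G₂ b → bits G₁ a ≡ bits G₂ b
name-injective G₁ G₂ len a b eq = proj₂ (fromBits-injective 0 0 (bits G₁ a) (bits G₂ b) bits-length
  (trans (sym (name≡fromBits G₁ a)) (trans eq (name≡fromBits G₂ b))))
  where
  bits-length = trans (length-map _ (sets G₁)) (trans (sets-length G₁ G₂ len) (sym (length-map _ (sets G₂))))

-- S₁ and S₂ are unions of the same independent sets of G₁ resp. G₂
Corresponding : (G₁ G₂ : List Rule) → (S₁ S₂ : List Atom) → Set
Corresponding G₁ G₂ S₁ S₂ =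
  (∀ a b → name G₁ a ≡ name G₂ b → a ∈ᵇ S₁ ≡ b ∈ᵇ S₂) × S₁ ⊆ˡ atoms G₁ × S₂ ⊆ˡ atoms G₂

sets-correspond : ∀ G₁ G₂ → length G₁ ≡ length G₂ → Pointwise (Corresponding G₁ G₂) (sets G₁) (sets G₂)
sets-correspond G₁ G₂ len =
  go (sets G₁) (sets G₂) (sets-length G₁ G₂ len) (name-injective G₁ G₂ len) id id
  where
  go : ∀ SS₁ SS₂ → length SS₁ ≡ length SS₂
     → (∀ a b → name G₁ a ≡ name G₂ b → map (a ∈ᵇ_) SS₁ ≡ map (b ∈ᵇ_) SS₂)
     → concat SS₁ ⊆ˡ atoms G₁ → concat SS₂ ⊆ˡ atoms G₂
     → Pointwise (Corresponding G₁ G₂) SS₁ SS₂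
  go []         []         _   _    _  _  = []
  go (S₁ ∷ SS₁) (S₂ ∷ SS₂) len same ⊆₁ ⊆₂ =
    ((λ a b eq → ∷-injectiveˡ (same a b eq)) , ⊆₁ ∘ ∈-++⁺ˡ , ⊆₂ ∘ ∈-++⁺ˡ)
    ∷ go SS₁ SS₂ (suc-injective len) (λ a b eq → ∷-injectiveʳ (same a b eq)) (⊆₁ ∘ ∈-++⁺ʳ S₁) (⊆₂ ∘ ∈-++⁺ʳ S₂)

pointwise-sets : ∀ {R : List Atom → List Atom → Set} G₁ G₂ → Pointwise R (sets G₁) (sets G₂)
  → Pointwise (λ r₁ r₂ → R (head r₁) (head r₂) × R (pos r₁) (pos r₂) × R (neg r₁) (neg r₂)) G₁ G₂
pointwise-sets []        []        []                 = []
pointwise-sets (_ ∷ G₁) (_ ∷ G₂) (h ∷ p ∷ n ∷ rest) = (h , p , n) ∷ pointwise-sets G₁ G₂ rest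

pointwise-++⁻ : ∀ {B C : Set} {R : B → C → Set} ws {xs} ys {zs} → length ws ≡ length ys
  → Pointwise R (ws ++ xs) (ys ++ zs) → Pointwise R ws ys × Pointwise R xs zs
pointwise-++⁻ []       []       _   rest         = [] , rest
pointwise-++⁻ (w ∷ ws) (y ∷ ys) len (wRy ∷ rest) =
  let left , right = pointwise-++⁻ ws ys (suc-injective len) rest in wRy ∷ left , right

-- Transport of interpretations between tuples with matching independent sets

Hit : List Rule → Interp → ℕ → Bool → Set
Hit G Z k v = ∃[ a ] InIS G k a × Z a ≡ v

classAny : List Rule → (Atom → Bool) → ℕ → Bool
classAny G p k = any (λ a → (name G a ≡ᵇ k) ∧ p a) (atoms G)

classAny⇔ : ∀ G p {k} → 1 ≤ k → classAny G p k ≡ true ⇔ Hit G p k true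
classAny⇔ G p {k} 1≤k = mk⇔ witness hit
  where
  witness : classAny G p k ≡ true → Hit G p k true
  witness h = let a , _ , h′ = to (any≡true⇔ _ (atoms G)) h ; a∈k , pa = ∧-≡true h′ in a , to ≡ᵇ⇔≡ a∈k , pa
  hit : Hit G p k true → classAny G p k ≡ true
  hit (a , a∈k , pa) = from (any≡true⇔ _ (atoms G))
    (a , from (∈atoms⇔1≤name G) (subst (1 ≤_) (sym a∈k) 1≤k) , cong₂ _∧_ (from (≡ᵇ⇔≡ {name G a}) a∈k) pa)

classAny-mono : ∀ G {p q} k → (∀ a → p a ≡ true → q a ≡ true) → classAny G p k ≡ true → classAny G q k ≡ true
classAny-mono G {p} {q} k p⇒q h =
  let a , a∈ , h′ = to (any≡true⇔ _ (atoms G)) h ; a∈k , pa = ∧-≡true h′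
  in from (any≡true⇔ _ (atoms G)) (a , a∈ , cong₂ _∧_ a∈k (p⇒q a pa))

firstWith : (A → Bool) → A → List A → A
firstWith p d []       = d
firstWith p d (x ∷ xs) = if p x then x else firstWith p d xs

firstWith-satisfies : ∀ (p : A → Bool) d xs → any p xs ≡ true → p (firstWith p d xs) ≡ true
firstWith-satisfies p d (x ∷ xs) h with p x in px
... | true  = px
... | false = firstWith-satisfies p d xs h

module Lift (G₁ G₂ : List Rule)
            (same-nis : ∀ k → nis G₁ k ⇔ nis G₂ k) (sis₂⇒sis₁ : ∀ k → sis G₂ k → sis G₁ k) where

  hasTrue hasFalse : Interp → ℕ → Bool
  hasTrue  Z = classAny G₁ Z
  hasFalse Z = classAny G₁ (not ∘ Z)

  hasFalse⇔ : ∀ Z {k} → 1 ≤ k → hasFalse Z k ≡ true ⇔ Hit G₁ Z k false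
  hasFalse⇔ Z 1≤k = mk⇔
    (λ h → let a , a∈k , nZa = to (classAny⇔ G₁ (not ∘ Z) 1≤k) h in a , a∈k , not-injective nZa)
    (λ (a , a∈k , Za) → from (classAny⇔ G₁ (not ∘ Z) 1≤k) (a , a∈k , cong not Za))

  -- junk value 0 for empty classes, which never matter
  rep : ℕ → Atom
  rep k = firstWith (λ b → name G₂ b ≡ᵇ k) 0 (atoms G₂)

  rep-∈ : ∀ {k} → nis G₂ k → InIS G₂ k (rep k)
  rep-∈ {k} (1≤k , b , b∈k) = to ≡ᵇ⇔≡ (firstWith-satisfies _ 0 (atoms G₂)
    (from (any≡true⇔ _ (atoms G₂)) (b , from (∈atoms⇔1≤name G₂) (subst (1 ≤_) (sym b∈k) 1≤k) , from (≡ᵇ⇔≡ {name G₂ b}) b∈k)))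

  -- Z constant on class k of G₁ gives the same constant on class k of G₂; Z mixed gives lift Z mixed.
  liftAt : Interp → ℕ → Atom → Bool
  liftAt Z k b = if hasTrue Z k then (if hasFalse Z k then b ≡ᵇ rep k else true) else false

  lift : Interp → Interp
  lift Z b = liftAt Z (name G₂ b) b

  lift-mono : ∀ {Y X} → Y ⊆ X → lift Y ⊆ lift X
  lift-mono {Y} {X} Y⊆X b Yb
    with hasTrue Y (name G₂ b) in tY | hasTrue X (name G₂ b) in tX
       | hasFalse Y (name G₂ b) in fY | hasFalse X (name G₂ b) in fX
  ... | false | _     | _     | _     = ⊥-elim (true≢false (sym Yb))
  ... | true  | false | _     | _     = ⊥-elim (true≢false (trans (sym (classAny-mono G₁ _ Y⊆X tY)) tX))
  ... | true  | true  | _     | false = refl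
  ... | true  | true  | true  | true  = Yb
  ... | true  | true  | false | true  = ⊥-elim (true≢false (trans (sym (classAny-mono G₁ _ X⊉Y fX)) fY))
    where
    X⊉Y : ∀ a → not (X a) ≡ true → not (Y a) ≡ true
    X⊉Y a nXa = cong not (¬-not λ Ya → true≢false (trans (sym (Y⊆X a Ya)) (not-injective nXa)))

  module _ (Z : Interp) {k : ℕ} where

    liftAt-false : hasTrue Z k ≡ false → ∀ b → liftAt Z k b ≡ false
    liftAt-false t b rewrite t = refl

    liftAt-true : hasTrue Z k ≡ true → hasFalse Z k ≡ false → ∀ b → liftAt Z k b ≡ true
    liftAt-true t f b rewrite t | f = refl

    liftAt-mixed : hasTrue Z k ≡ true → hasFalse Z k ≡ true → ∀ b → liftAt Z k b ≡ (b ≡ᵇ rep k)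
    liftAt-mixed t f b rewrite t | f = refl

  module _ (Z : Interp) {k : ℕ} (1≤k : 1 ≤ k) where

    lift-at : ∀ b → InIS G₂ k b → lift Z b ≡ liftAt Z k b
    lift-at b b∈k = cong (λ k′ → liftAt Z k′ b) b∈k

    hasTrue-hit : Hit G₁ Z k true → hasTrue Z k ≡ true
    hasTrue-hit = from (classAny⇔ G₁ Z 1≤k)

    rep-hit : ∀ {v} → Hit G₁ Z k v → InIS G₂ k (rep k)
    rep-hit (a , a∈k , _) = rep-∈ (to (same-nis k) (1≤k , a , a∈k))

    hit-rep : ∀ {v} → Hit G₁ Z k v → liftAt Z k (rep k) ≡ v → Hit G₂ (lift Z) k v
    hit-rep hit eq = rep k , rep-hit hit , trans (lift-at (rep k) (rep-hit hit)) eq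

    all-false : hasTrue Z k ≡ false → nis G₁ k → Hit G₁ Z k false
    all-false t (_ , a , a∈k) = a , a∈k , ¬-not λ Za → true≢false (trans (sym (hasTrue-hit (a , a∈k , Za))) t)

    mixed-not-singleton : Hit G₁ Z k true → Hit G₁ Z k false → ¬ sis G₂ k
    mixed-not-singleton (a , a∈k , Za) (a′ , a′∈k , Za′) sis₂ =
      let _ , _ , _ , unique = sis₂⇒sis₁ k sis₂
      in true≢false (trans (sym Za) (trans (cong Z (trans (unique a a∈k) (sym (unique a′ a′∈k)))) Za′))

    -- a mixed class of G₁ has at least two atoms, hence so has the class of G₂
    other-than-rep : Hit G₁ Z k true → Hit G₁ Z k false → Hit G₂ (λ b → not (b ≡ᵇ rep k)) k true
    other-than-rep hitT hitF with classAny G₂ (λ b → not (b ≡ᵇ rep k)) k in other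
    ... | true  = to (classAny⇔ G₂ _ 1≤k) other
    ... | false = ⊥-elim (mixed-not-singleton hitT hitF (1≤k , rep k , rep-hit hitT , is-rep))
      where
      is-rep : ∀ b → InIS G₂ k b → b ≡ rep k
      is-rep b b∈k with b ≡ᵇ rep k in b≡rep
      ... | true  = to ≡ᵇ⇔≡ b≡rep
      ... | false = ⊥-elim (true≢false (trans (sym (from (classAny⇔ G₂ _ 1≤k) (b , b∈k , cong not b≡rep))) other))

    true→ : Hit G₁ Z k true → Hit G₂ (lift Z) k true
    true→ hit with hasFalse Z k in f
    ... | true  = hit-rep hit (trans (liftAt-mixed Z (hasTrue-hit hit) f (rep k)) (from (≡ᵇ⇔≡ {rep k}) refl))
    ... | false = hit-rep hit (liftAt-true Z (hasTrue-hit hit) f (rep k))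

    false→ : Hit G₁ Z k false → Hit G₂ (lift Z) k false
    false→ hit with hasTrue Z k in t
    ... | false = hit-rep hit (liftAt-false Z t (rep k))
    ... | true  =
      let b , b∈k , b≢rep = other-than-rep (to (classAny⇔ G₁ Z 1≤k) t) hit
          f = from (hasFalse⇔ Z 1≤k) hit
      in b , b∈k , trans (lift-at b b∈k) (trans (liftAt-mixed Z t f b) (not-injective b≢rep))

    true← : Hit G₂ (lift Z) k true → Hit G₁ Z k true
    true← (b , b∈k , Lb) with hasTrue Z k in t
    ... | true  = to (classAny⇔ G₁ Z 1≤k) t
    ... | false = ⊥-elim (true≢false (trans (sym Lb) (trans (lift-at b b∈k) (liftAt-false Z t b))))

    false← : Hit G₂ (lift Z) k false → Hit G₁ Z k false
    false← (b , b∈k , Lb) with hasTrue Z k in t | hasFalse Z k in f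
    ... | _     | true  = to (hasFalse⇔ Z 1≤k) f
    ... | false | false = all-false t (from (same-nis k) (1≤k , b , b∈k))
    ... | true  | false = ⊥-elim (true≢false (trans (sym (liftAt-true Z t f b)) (trans (sym (lift-at b b∈k)) Lb)))

    lift-hits : ∀ v → Hit G₁ Z k v ⇔ Hit G₂ (lift Z) k v
    lift-hits true  = mk⇔ true→ true←
    lift-hits false = mk⇔ false→ false←

  module _ {S₁ S₂ : List Atom} (S₁∼S₂ : Corresponding G₁ G₂ S₁ S₂) (Z : Interp) where

    lift-hits-in : ∀ v → (∃[ a ] a ∈ S₁ × Z a ≡ v) ⇔ (∃[ b ] b ∈ S₂ × lift Z b ≡ v)
    lift-hits-in v = mk⇔ forth back
      where
      same = proj₁ S₁∼S₂
      forth : ∃[ a ] a ∈ S₁ × Z a ≡ v → ∃[ b ] b ∈ S₂ × lift Z b ≡ v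
      forth (a , a∈S₁ , Za) =
        let b , b∈k , Lb = to (lift-hits Z (to (∈atoms⇔1≤name G₁) (proj₁ (proj₂ S₁∼S₂) a∈S₁)) v) (a , refl , Za)
        in b , to ∈ᵇ⇔∈ (trans (sym (same a b (sym b∈k))) (from ∈ᵇ⇔∈ a∈S₁)) , Lb
      back : ∃[ b ] b ∈ S₂ × lift Z b ≡ v → ∃[ a ] a ∈ S₁ × Z a ≡ v
      back (b , b∈S₂ , Lb) =
        let a , a∈k , Za = from (lift-hits Z (to (∈atoms⇔1≤name G₂) (proj₂ (proj₂ S₁∼S₂) b∈S₂)) v) (b , refl , Lb)
        in a , to ∈ᵇ⇔∈ (trans (same a b a∈k) (from ∈ᵇ⇔∈ b∈S₂)) , Za

    any-lift : any Z S₁ ≡ any (lift Z) S₂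
    any-lift = ⇔→≡ (⇔-trans (any≡true⇔ Z S₁) (⇔-trans (lift-hits-in true) (⇔-sym (any≡true⇔ (lift Z) S₂))))

    all-lift : all Z S₁ ≡ all (lift Z) S₂
    all-lift = ⇔→≡ (⇔-trans (all≡false⇔ Z S₁) (⇔-trans (lift-hits-in false) (⇔-sym (all≡false⇔ (lift Z) S₂))))

  lift-≅ : length G₁ ≡ length G₂ → Pointwise (_≅[ lift ]_) G₁ G₂
  lift-≅ len = pointwise-map (λ (h , p , n) Z → cong₂ _,_ (any-lift h Z) (cong₂ _,_ (all-lift p Z) (any-lift n Z)))
                             (pointwise-sets G₁ G₂ (sets-correspond G₁ G₂ len))

SE-sym : ∀ e P Q → SE e P Q → SE e Q P
SE-sym e P Q P≡Q R X = ⇔-sym (P≡Q R X)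

SE-transfer : ∀ e {P₁ Q₁ P₂ Q₂} → (P₁ , Q₁) ≈ (P₂ , Q₂)
  → (∀ k → nis (P₁ ++ Q₁) k ⇔ nis (P₂ ++ Q₂) k) → (∀ k → sis (P₂ ++ Q₂) k → sis (P₁ ++ Q₁) k)
  → SE e P₂ Q₂ → SE e P₁ Q₁
SE-transfer e {P₁} {Q₁} {P₂} {Q₂} (|P| , |Q|) same-nis sis₂⇒sis₁ P₂≡Q₂ =
  SEModels⇒SE e P₁ Q₁ (SEModels⊆-transport lift lift-mono P≅ Q≅ (SE⇒SEModels⊆ e P₂ Q₂ P₂≡Q₂))
                      (SEModels⊆-transport lift lift-mono Q≅ P≅ (SE⇒SEModels⊆ e Q₂ P₂ (SE-sym e P₂ Q₂ P₂≡Q₂)))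
  where
  open Lift (P₁ ++ Q₁) (P₂ ++ Q₂) same-nis sis₂⇒sis₁
  P≅Q≅ = pointwise-++⁻ P₁ P₂ |P|
           (lift-≅ (trans (length-++ P₁) (trans (cong₂ _+_ |P| |Q|) (sym (length-++ P₂)))))
  P≅ = proj₁ P≅Q≅
  Q≅ = proj₂ P≅Q≅

theorem8 : (e : Semantics) (P₁ Q₁ P₂ Q₂ : Program)
    → (P₁ , Q₁) ≈ (P₂ , Q₂)
    → (ICeq (P₁ , Q₁) (P₂ , Q₂) → (SE e P₁ Q₁ ⇔ SE e P₂ Q₂))
      × (IClt (P₁ , Q₁) (P₂ , Q₂)
          → (¬ SE e P₁ Q₁ → ¬ SE e P₂ Q₂) × (SE e P₂ Q₂ → SE e P₁ Q₁))
theorem8 e P₁ Q₁ P₂ Q₂ T₁≈T₂@(|P| , |Q|) =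
    (λ (same-nis , same-sis) →
       mk⇔ (SE-transfer e (sym |P| , sym |Q|) (⇔-sym ∘ same-nis) (to ∘ same-sis))
           (SE-transfer e T₁≈T₂ same-nis (from ∘ same-sis)))
  , λ (same-nis , sis₂⊆sis₁ , _) →
      let P₂≡Q₂⇒P₁≡Q₁ = SE-transfer e T₁≈T₂ same-nis sis₂⊆sis₁
      in (λ P₁≢Q₁ → P₁≢Q₁ ∘ P₂≡Q₂⇒P₁≡Q₁) , P₂≡Q₂⇒P₁≡Q₁
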